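{- Let $\mathfrak{T}=\langle\mathcal{M},\mathcal{E}\rangle$ be a value-consistent constrained equational theory over a signature $\Sigma$, and $U$ a set of variables. Let $\sim_\mathcal{E}=\{\langle[s]_c,[t]_c\rangle\mid s\leftrightarrow^*_\mathcal{E}t\}$ on the elements of the term algebra $T[\mathcal{M}](\Sigma,U)$. Then $\sim_\mathcal{E}$ is a congruence relation on $T[\mathcal{M}](\Sigma,U)$.
   Context: Signature $\Sigma$: sorts $\mathcal{S} = \mathcal{S}_{th} \uplus \mathcal{S}_{te}$ (theory/term sorts), function symbols $\mathcal{F} = \mathcal{F}_{th} \uplus \mathcal{F}_{te}$ with sort declarations; theory symbols have only theory sorts. Sorted variables $\mathcal{V} = \mathcal{V}_{th}\uplus\mathcal{V}_{te}$. A model $\mathcal{M} = \langle \mathcal{I},\mathcal{J}\rangle$ assigns a non-empty set $\mathcal{I}(\tau)$ to each theory sort and a function $\mathcal{J}(f)$ to each $f \in\mathcal{F}_{th}$; for each theory sort $\tau$ a set $\mathrm{Val}_\tau\subseteq\mathcal{F}_{th}$ of constants ("values") is mapped bijectively onto $\mathcal{I}(\tau)$ by $\mathcal{J}$ (values identified with their interpretations); $\mathrm{Val}=\bigcup_\tau\mathrm{Val}_\tau$. Sort $\mathsf{Bool}$ with $\mathcal{I}(\mathsf{Bool})=\{\mathsf{true},\mathsf{false}\}$, standard connectives and equality symbols. Logical constraints: terms of $\mathcal{T}(\mathcal{F}_{th},\mathcal{V})$ of sort $\mathsf{Bool}$; $\models_\mathcal{M}\varphi$ means true under every valuation. Substitutions: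 sort-preserving, finite domain; $\mathcal{V}\mathrm{Dom}(\sigma)=\{x\in\mathrm{Dom}(\sigma)\mid\sigma(x)\in\mathrm{Val}\}$; $\sigma$ is $X$-valued if $X\subseteq\mathcal{V}\mathrm{Dom}(\sigma)$. Calculation step $s\to_{calc}t$: $s=C[f(c_1,\dots,c_n)]$, $t=C[c_0]$, $f\in\mathcal{F}_{th}\setminus\mathrm{Val}$, $c_i\in\mathrm{Val}$, $c_0=\mathcal{J}(f)(c_1,\dots,c_n)$; $\leftrightarrow_{calc}$ its symmetric closure. A CE $\Pi X.\ s\approx t\ [\varphi]$: terms of equal sort, logical constraint $\varphi$, $X\subseteq\mathcal{V}_{th}$ with $\mathrm{Var}(\varphi)\subseteq X$. Theory $\langle\mathcal{M},\mathcal{E}\rangle$: $\mathcal{E}$ a set of CEs. $s\leftrightarrow_{rule,\mathcal{E}}t$ iff $s=C[\ell\sigma]$, $t=C[r\sigma]$ (or vice versa) for some $\Pi X.\ \ell\approx r\ [\varphi]\in\mathcal{E}$ and $X$-valued $\sigma$ with $\models_\mathcal{M}\varphi\sigma$; $\leftrightarrow_\mathcal{E}=\leftrightarrow_{calc}\cup\leftrightarrow_{rule,\mathcal{E}}$. $\mathfrak{T}$ is value-consistent if for all theory sorts $\tau$ and $u,v\in\mathrm{Val}_\tau$, $u\leftrightarrow^*_\mathcal{E}v$ implies $u=v$. A CE-$\langle\Sigma,\mathcal{M}\rangle$-algebra $\mathfrak{M}=\langle\mathfrak{I},\mathfrak{J}\rangle$ assigns a non-empty set $\mathfrak{I}(\tau)$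 to each $\tau\in\mathcal{S}$ and a function $\mathfrak{J}(f)$ of matching arity to each $f\in\mathcal{F}$, with $\mathfrak{I}(\tau)\supseteq\mathcal{I}(\tau)$ for $\tau\in\mathcal{S}_{th}$ and $\mathfrak{J}(f)$ agreeing with $\mathcal{J}(f)$ on arguments from the $\mathcal{I}(\tau_i)$ for $f\in\mathcal{F}_{th}$. A congruence relation on a CE-$\langle\Sigma,\mathcal{M}\rangle$-algebra is a sort-indexed family $(\sim^\tau)_{\tau\in\mathcal{S}}$ such that (1) $\sim^\tau$ is an equivalence relation on $\mathfrak{I}(\tau)$, (2) $\sim^\tau\cap\mathcal{I}(\tau)^2$ is the identity relation for $\tau\in\mathcal{S}_{th}$, and (3) for each $f\colon\tau_1\times\cdots\times\tau_n\to\tau_0$ in $\mathcal{F}$, $a_i\sim^{\tau_i}b_i$ for all $i$ implies $\mathfrak{J}(f)(a_1,\dots,a_n)\sim^{\tau_0}\mathfrak{J}(f)(b_1,\dots,b_n)$. Term algebra $T[\mathcal{M}](\Sigma,U)$: carriers $\mathfrak{I}(\tau)=\mathcal{T}(\mathcal{F},U)^\tau/{\sim_c}$ with $\sim_c=\leftrightarrow^*_{calc}$ and $[t]_c$ the class of $t$; operations $\mathfrak{J}(f)([t_1]_c,\dots,[t_n]_c)=[f(t_1,\dots,t_n)]_c$; each value $v\in\mathrm{Val}_\tau$ is identified with $[v]_c$, so $\mathcal{I}(\tau)\subseteq\mathfrak{I}(\tau)$. -}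

module Defs where

open import Data.List using (List; []; _∷_; map)
open import Data.List.Relation.Unary.All using (All; []; _∷_)
open import Data.Product using (Σ; _×_; _,_; proj₁; proj₂)
open import Data.Sum using (_⊎_; inj₁; inj₂)
open import Data.Bool using (Bool; true)
open import Data.Empty using (⊥)
open import Data.Unit using (⊤)
open import Relation.Nullary using (¬_)
open import Relation.Binary.PropositionalEquality using (_≡_; subst; sym)
open import Relation.Binary.Structures using (IsEquivalence)
open import Relation.Binary.Construct.Closure.ReflexiveTransitive using (Star)
open import Relation.Binary.Construct.Closure.Symmetric using (SymClosure)
open import Function.Bundles using (_↔_; Inverse)

record Signature : Set₁ where
  field
    SortTh SortTe : Set
    FunTh FunTe   : Set
    VarTh VarTe   : Set
    boolS   : SortTh
    arityTh : FunTh → List SortTh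
    resTh   : FunTh → SortTh
  Sort : Set
  Sort = SortTh ⊎ SortTe
  field
    arityTe : FunTe → List Sort
    resTe   : FunTe → Sort
    vsortTh : VarTh → SortTh
    vsortTe : VarTe → SortTe
  Fun : Set
  Fun = FunTh ⊎ FunTe
  Var : Set
  Var = VarTh ⊎ VarTe
  arity : Fun → List Sort
  arity (inj₁ f) = map inj₁ (arityTh f)
  arity (inj₂ f) = arityTe f
  res : Fun → Sort
  res (inj₁ f) = inj₁ (resTh f)
  res (inj₂ f) = resTe f
  vsort : Var → Sort
  vsort (inj₁ x) = inj₁ (vsortTh x)
  vsort (inj₂ x) = inj₂ (vsortTe x)

module _ (Sig : Signature) where
  open Signature Sig

  mutual
    data Term (Y : Set) (ys : Y → Sort) : Sort → Set where
      var : (y : Y) → Term Y ys (ys y)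
      fun : (f : Fun) → Args Y ys (arity f) → Term Y ys (res f)

    data Args (Y : Set) (ys : Y → Sort) : List Sort → Set where
      []  : Args Y ys []
      _∷_ : ∀ {σ σs} → Term Y ys σ → Args Y ys σs → Args Y ys (σ ∷ σs)

  mutual
    data ThTerm (Y : Set) (ys : Y → SortTh) : SortTh → Set where
      var : (y : Y) → ThTerm Y ys (ys y)
      fun : (f : FunTh) → ThArgs Y ys (arityTh f) → ThTerm Y ys (resTh f)

    data ThArgs (Y : Set) (ys : Y → SortTh) : List SortTh → Set where
      []  : ThArgs Y ys []
      _∷_ : ∀ {τ τs} → ThTerm Y ys τ → ThArgs Y ys τs → ThArgs Y ys (τ ∷ τs)

  mutual
    applyS : ∀ {Y ys Z zs σ} → ((y : Y) → Term Z zs (ys y)) → Term Y ys σ → Term Z zs σ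
    applyS θ (var y)    = θ y
    applyS θ (fun f ts) = fun f (applyArgs θ ts)

    applyArgs : ∀ {Y ys Z zs σs} → ((y : Y) → Term Z zs (ys y)) → Args Y ys σs → Args Z zs σs
    applyArgs θ []       = []
    applyArgs θ (t ∷ ts) = applyS θ t ∷ applyArgs θ ts

  TRel : (Y : Set) → (Y → Sort) → Set₁
  TRel Y ys = ∀ {σ} → Term Y ys σ → Term Y ys σ → Set

  mutual
    data Ctx {Y : Set} {ys : Y → Sort} (R : TRel Y ys) : ∀ {σ} → Term Y ys σ → Term Y ys σ → Set where
      root : ∀ {σ} {s t : Term Y ys σ} → R s t → Ctx R s t
      arg  : ∀ f {ss ts : Args Y ys (arity f)} → CtxArgs R ss ts → Ctx R (fun f ss) (fun f ts)

    data CtxArgs {Y : Set} {ys : Y → Sort} (R : TRel Y ys) : ∀ {σs} → Args Y ys σs → Args Y ys σs → Set where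
      here  : ∀ {σ σs} {s t : Term Y ys σ} {ss : Args Y ys σs} → Ctx R s t → CtxArgs R (s ∷ ss) (t ∷ ss)
      there : ∀ {σ σs} {s : Term Y ys σ} {ss ts : Args Y ys σs} → CtxArgs R ss ts → CtxArgs R (s ∷ ss) (s ∷ ts)

  Conv : ∀ {Y ys} → TRel Y ys → TRel Y ys
  Conv R {σ} = Star (SymClosure (Ctx R {σ}))

  data ArgsRel {Y : Set} {ys : Y → Sort} (R : TRel Y ys) : ∀ {σs} → Args Y ys σs → Args Y ys σs → Set where
    []  : ArgsRel R [] []
    _∷_ : ∀ {σ σs} {s t : Term Y ys σ} {ss ts : Args Y ys σs} → R s t → ArgsRel R ss ts → ArgsRel R (s ∷ ss) (t ∷ ts)

  record Model : Set₁ where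
    field
      I : SortTh → Set
      J : (f : FunTh) → All I (arityTh f) → I (resTh f)
      boolIso : I boolS ↔ Bool
      IsVal : FunTh → Set
      isVal-const : ∀ f → IsVal f → arityTh f ≡ []
    valI : (f : FunTh) → IsVal f → I (resTh f)
    valI f p = J f (subst (All I) (sym (isVal-const f p)) [])
    field
      val-inj  : ∀ f g (p : IsVal f) (q : IsVal g) (e : resTh f ≡ resTh g) →
                 subst I e (valI f p) ≡ valI g q → f ≡ g
      val-surj : ∀ τ (a : I τ) → Σ FunTh λ f → Σ (IsVal f) λ p → Σ (resTh f ≡ τ) λ e →
                 subst I e (valI f p) ≡ a

  module _ (M : Model) where
    open Model M

    ThI : Sort → Set
    ThI (inj₁ τ) = I τ
    ThI (inj₂ _) = ⊥

    data Denotes {Y : Set} {ys : Y → Sort} : ∀ {σ} → Term Y ys σ → ThI σ → Set where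
      den : ∀ f (as : Args Y ys (arity (inj₁ f))) (p : IsVal f) → Denotes (fun (inj₁ f) as) (valI f p)

    DenArgs : ∀ {Y ys} τs → Args Y ys (map inj₁ τs) → All I τs → Set
    DenArgs []       []       []       = ⊤
    DenArgs (τ ∷ τs) (t ∷ ts) (a ∷ as) = Denotes t a × DenArgs τs ts as

    data CalcRoot {Y : Set} {ys : Y → Sort} : ∀ {σ} → Term Y ys σ → Term Y ys σ → Set where
      calc : ∀ f → ¬ IsVal f → (ts : Args Y ys (map inj₁ (arityTh f))) (as : All I (arityTh f)) →
             DenArgs (arityTh f) ts as →
             (t₀ : Term Y ys (inj₁ (resTh f))) → Denotes t₀ (J f as) →
             CalcRoot (fun (inj₁ f) ts) t₀

    mutual
      evalTh : ∀ {Y ys τ} → ((y : Y) → I (ys y)) → ThTerm Y ys τ → I τ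
      evalTh ρ (var y)    = ρ y
      evalTh ρ (fun f ts) = J f (evalArgs ρ ts)

      evalArgs : ∀ {Y ys τs} → ((y : Y) → I (ys y)) → ThArgs Y ys τs → All I τs
      evalArgs ρ []       = []
      evalArgs ρ (t ∷ ts) = evalTh ρ t ∷ evalArgs ρ ts

  -- Constrained equations Π X. ℓ ≈ r [φ]  (X ⊆ V_th, Var(φ) ⊆ X by typing)

  record CE : Set₁ where
    field
      X   : VarTh → Set
      srt : Sort
      lhs rhs : Term Var vsort srt
      φ   : ThTerm (Σ VarTh X) (λ x → vsortTh (proj₁ x)) boolS

  record CETheory : Set₁ where
    field
      model : Model
      Idx   : Set
      rules : Idx → CE

  module _ (T : CETheory) where
    open CETheory T
    open Model model

    -- root rule step ℓσ → rσ, σ X-valued (σ(x) is the value with J-value vals x), ⊨ φσ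
    data RuleRoot {Y : Set} {ys : Y → Sort} : ∀ {σ} → Term Y ys σ → Term Y ys σ → Set where
      rule : (i : Idx) (θ : (x : Var) → Term Y ys (vsort x))
             (vals : ∀ x → CE.X (rules i) x → I (vsortTh x)) →
             (∀ x (px : CE.X (rules i) x) → Denotes model (θ (inj₁ x)) (vals x px)) →
             Inverse.to boolIso (evalTh model (λ y → vals (proj₁ y) (proj₂ y)) (CE.φ (rules i))) ≡ true →
             RuleRoot (applyS θ (CE.lhs (rules i))) (applyS θ (CE.rhs (rules i)))

    RootE : ∀ {Y ys} → TRel Y ys
    RootE s t = CalcRoot model s t ⊎ RuleRoot s t

    ConvE : ∀ {Y ys} → TRel Y ys
    ConvE = Conv RootE

    ConvCalc : ∀ {Y ys} → TRel Y ys
    ConvCalc = Conv (CalcRoot model)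

    ValueConsistent : Set
    ValueConsistent = ∀ τ (u v : Term Var vsort (inj₁ τ)) a b →
      Denotes model u a → Denotes model v b → ConvE u v → u ≡ v

    -- Term algebra T[M](Σ,U): carriers are U-terms modulo ∼_c, so a relation on
    -- classes is represented by a relation on representatives.
    UVar : (Var → Set) → Set
    UVar U = Σ Var U

    uvsort : (U : Var → Set) → UVar U → Sort
    uvsort U y = vsort (proj₁ y)

    SimE : (U : Var → Set) → TRel (UVar U) (uvsort U)
    SimE U a b = Σ _ λ s → Σ _ λ t → ConvCalc a s × ConvCalc b t × ConvE s t

    record IsTACongruence (U : Var → Set) (R : TRel (UVar U) (uvsort U)) : Set where
      field
        -- R is a relation on ∼_c-classes
        well-defined : ∀ {σ} {a a' b b' : Term (UVar U) (uvsort U) σ} →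
                       ConvCalc a a' → ConvCalc b b' → R a b → R a' b'
        equivalence  : ∀ {σ} → IsEquivalence (R {σ})
        -- (2) identity on I(τ) ⊆ 𝔍(τ) (values identified with their classes)
        values-id    : ∀ {τ} {u v : Term (UVar U) (uvsort U) (inj₁ τ)} {a b} →
                       Denotes model u a → Denotes model v b → R u v → ConvCalc u v
        compatible   : ∀ f {ss ts : Args (UVar U) (uvsort U) (arity f)} →
                       ArgsRel R ss ts → R (fun f ss) (fun f ts)

{-# OPTIONS --safe #-}
-- Since ↔_calc ⊆ ↔_E, the relation s ∼_E t holds exactly when s ↔*_E t. Hence ∼_E is an
-- equivalence, does not depend on the chosen representatives, and, being the equivalence
-- closure of a context-closed relation, is compatible with every function symbol. For (2),
-- rename the variables from U into V: the renaming preserves ↔_E-steps and keeps values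
-- values, so value-consistency identifies the renamed values, and as values are constants
-- the original ones coincide.
module Submission where

open import Defs
open import Data.List using (List; []; _∷_; map)
open import Data.List.Relation.Unary.All using ([]; _∷_)
open import Data.Maybe using (Maybe; just; nothing)
open import Data.Product using (Σ; _,_; proj₁)
open import Data.Product.Properties.WithK using (,-injectiveʳ)
open import Data.Sum using (inj₁; inj₂)
open import Data.Unit using (tt)
open import Function.Base using (_∘_)
open import Relation.Nullary using (Irrelevant)
open import Relation.Binary.PropositionalEquality using (_≡_; refl; cong; cong₂; subst; subst₂; sym)
open import Relation.Binary.Construct.Closure.ReflexiveTransitive using (ε; _◅◅_)
open import Relation.Binary.Construct.Closure.Equivalence as EqClosure using (EqClosure)

module _ (Sig : Signature) where
  open Signature Sig

  private variable
    Y Z W : Set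
    ys : Y → Sort
    zs : Z → Sort
    ws : W → Sort
    σ σ' : Sort
    σs : List Sort

  head : Term Sig Y ys σ → Maybe Fun
  head (var _)   = nothing
  head (fun f _) = just f

  Args-irrelevant : σs ≡ [] → Irrelevant (Args Sig Y ys σs)
  Args-irrelevant refl [] [] = refl

  ArgsRel-map : {R S : TRel Sig Y ys} → (∀ {σ} {s t : Term Sig Y ys σ} → R s t → S s t) →
                {ss ts : Args Sig Y ys σs} → ArgsRel Sig R ss ts → ArgsRel Sig S ss ts
  ArgsRel-map h []       = []
  ArgsRel-map h (r ∷ rs) = h r ∷ ArgsRel-map h rs

  module _ (ρ : (y : Y) → Term Sig Z zs (ys y)) (θ : (w : W) → Term Sig Y ys (ws w)) where
    mutual
      applyS-∘ : (t : Term Sig W ws σ) →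
                 applyS Sig ρ (applyS Sig θ t) ≡ applyS Sig (applyS Sig ρ ∘ θ) t
      applyS-∘ (var w)    = refl
      applyS-∘ (fun f ts) = cong (fun f) (applyArgs-∘ ts)

      applyArgs-∘ : (ts : Args Sig W ws σs) →
                    applyArgs Sig ρ (applyArgs Sig θ ts) ≡ applyArgs Sig (applyS Sig ρ ∘ θ) ts
      applyArgs-∘ []       = refl
      applyArgs-∘ (t ∷ ts) = cong₂ _∷_ (applyS-∘ t) (applyArgs-∘ ts)

  module _ {R S : TRel Sig Y ys} (h : ∀ {σ} {s t : Term Sig Y ys σ} → R s t → S s t) where
    mutual
      Ctx-map : {s t : Term Sig Y ys σ} → Ctx Sig R s t → Ctx Sig S s t
      Ctx-map (root r)  = root (h r)
      Ctx-map (arg f c) = arg f (CtxArgs-map c)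

      CtxArgs-map : {ss ts : Args Sig Y ys σs} → CtxArgs Sig R ss ts → CtxArgs Sig S ss ts
      CtxArgs-map (here c)  = here (Ctx-map c)
      CtxArgs-map (there c) = there (CtxArgs-map c)

  module _ (ρ : (y : Y) → Term Sig Z zs (ys y)) {R : TRel Sig Y ys} {S : TRel Sig Z zs}
           (h : ∀ {σ} {s t : Term Sig Y ys σ} → R s t → S (applyS Sig ρ s) (applyS Sig ρ t)) where
    mutual
      Ctx-applyS : {s t : Term Sig Y ys σ} → Ctx Sig R s t →
                   Ctx Sig S (applyS Sig ρ s) (applyS Sig ρ t)
      Ctx-applyS (root r)  = root (h r)
      Ctx-applyS (arg f c) = arg f (CtxArgs-applyS c)

      CtxArgs-applyS : {ss ts : Args Sig Y ys σs} → CtxArgs Sig R ss ts →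
                       CtxArgs Sig S (applyArgs Sig ρ ss) (applyArgs Sig ρ ts)
      CtxArgs-applyS (here c)  = here (Ctx-applyS c)
      CtxArgs-applyS (there c) = there (CtxArgs-applyS c)

    Conv-applyS : {s t : Term Sig Y ys σ} → Conv Sig R s t →
                  Conv Sig S (applyS Sig ρ s) (applyS Sig ρ t)
    Conv-applyS = EqClosure.gmap (applyS Sig ρ) Ctx-applyS

  module _ {R : TRel Sig Y ys} where
    Conv-args : {ss ts : Args Sig Y ys σs} → ArgsRel Sig (Conv Sig R) ss ts →
                EqClosure (CtxArgs Sig R) ss ts
    Conv-args []                                 = ε
    Conv-args {ss = _ ∷ ss} {ts = t ∷ _} (p ∷ ps) =
      EqClosure.gmap (_∷ ss) here p ◅◅ EqClosure.gmap (t ∷_) there (Conv-args ps)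

    Conv-fun : ∀ f {ss ts : Args Sig Y ys (arity f)} → ArgsRel Sig (Conv Sig R) ss ts →
               Conv Sig R (fun f ss) (fun f ts)
    Conv-fun f = EqClosure.gmap (fun f) (arg f) ∘ Conv-args

  module _ (M : Model Sig) where
    open Model M

    module _ (ρ : (y : Y) → Term Sig Z zs (ys y)) where
      Denotes-applyS : {t : Term Sig Y ys σ} {a : ThI Sig M σ} →
                       Denotes Sig M t a → Denotes Sig M (applyS Sig ρ t) a
      Denotes-applyS (den f as p) = den f (applyArgs Sig ρ as) p

      DenArgs-applyS : ∀ τs (ts : Args Sig Y ys (map inj₁ τs)) as →
                       DenArgs Sig M τs ts as → DenArgs Sig M τs (applyArgs Sig ρ ts) as
      DenArgs-applyS []       []       []       _        = tt
      DenArgs-applyS (τ ∷ τs) (t ∷ ts) (a ∷ as) (d , ds) =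
        Denotes-applyS d , DenArgs-applyS τs ts as ds

      CalcRoot-applyS : {s t : Term Sig Y ys σ} → CalcRoot Sig M s t →
                        CalcRoot Sig M (applyS Sig ρ s) (applyS Sig ρ t)
      CalcRoot-applyS (calc f nv ts as ds t₀ d₀) =
        calc f nv (applyArgs Sig ρ ts) as (DenArgs-applyS _ ts as ds)
             (applyS Sig ρ t₀) (Denotes-applyS d₀)

      -- Values are constants, so a value term is determined by its head symbol, which
      -- the substitution leaves unchanged. same-head keeps the two sorts apart so that
      -- both Denotes proofs can be matched on.
      Denotes-applyS-injective : {u v : Term Sig Y ys σ} {a b : ThI Sig M σ} →
                                 Denotes Sig M u a → Denotes Sig M v b →
                                 applyS Sig ρ u ≡ applyS Sig ρ v → u ≡ v
      Denotes-applyS-injective du dv eq = ,-injectiveʳ (same-head du dv (cong head eq))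
        where
          same-head : {u : Term Sig Y ys σ} {v : Term Sig Y ys σ'}
                      {a : ThI Sig M σ} {b : ThI Sig M σ'} →
                      Denotes Sig M u a → Denotes Sig M v b →
                      head (applyS Sig ρ u) ≡ head (applyS Sig ρ v) →
                      _≡_ {A = Σ Sort (Term Sig Y ys)} (σ , u) (σ' , v)
          same-head (den f as p) (den .f bs q) refl =
            cong (λ args → _ , fun (inj₁ f) args)
                 (Args-irrelevant (cong (map inj₁) (isVal-const f p)) as bs)

  module Conversion (T : CETheory Sig) where
    open CETheory T

    module _ (ρ : (y : Y) → Term Sig Z zs (ys y)) where
      RuleRoot-applyS : {s t : Term Sig Y ys σ} → RuleRoot Sig T s t →
                        RuleRoot Sig T (applyS Sig ρ s) (applyS Sig ρ t)
      RuleRoot-applyS (rule i θ vals dθ ⊨φ) =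
        subst₂ (RuleRoot Sig T)
          (sym (applyS-∘ ρ θ (CE.lhs (rules i)))) (sym (applyS-∘ ρ θ (CE.rhs (rules i))))
          (rule i (applyS Sig ρ ∘ θ) vals (λ x px → Denotes-applyS model ρ (dθ x px)) ⊨φ)

      ConvE-applyS : {s t : Term Sig Y ys σ} → ConvE Sig T s t →
                     ConvE Sig T (applyS Sig ρ s) (applyS Sig ρ t)
      ConvE-applyS = Conv-applyS ρ λ where
        (inj₁ c) → inj₁ (CalcRoot-applyS model ρ c)
        (inj₂ r) → inj₂ (RuleRoot-applyS r)

    ConvCalc⇒ConvE : {s t : Term Sig Y ys σ} → ConvCalc Sig T s t → ConvE Sig T s t
    ConvCalc⇒ConvE = EqClosure.map (Ctx-map inj₁)

    module _ {U : Var → Set} {a b : Term Sig (UVar Sig T U) (uvsort Sig T U) σ} where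
      SimE⇒ConvE : SimE Sig T U a b → ConvE Sig T a b
      SimE⇒ConvE (_ , _ , a∼s , b∼t , s↔t) =
        ConvCalc⇒ConvE a∼s ◅◅ s↔t ◅◅ EqClosure.symmetric _ (ConvCalc⇒ConvE b∼t)

      ConvE⇒SimE : ConvE Sig T a b → SimE Sig T U a b
      ConvE⇒SimE a↔b = a , b , ε , ε , a↔b

    ConvE-values⇒≡ : ValueConsistent Sig T → (U : Var → Set) →
                     {τ : SortTh} {u v : Term Sig (UVar Sig T U) (uvsort Sig T U) (inj₁ τ)}
                     {a b : ThI Sig model (inj₁ τ)} →
                     Denotes Sig model u a → Denotes Sig model v b → ConvE Sig T u v → u ≡ v
    ConvE-values⇒≡ consistent U du dv u↔v =
      Denotes-applyS-injective model ρ du dv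
        (consistent _ _ _ _ _ (Denotes-applyS model ρ du) (Denotes-applyS model ρ dv)
                    (ConvE-applyS ρ u↔v))
      where
        ρ : (y : UVar Sig T U) → Term Sig Var vsort (uvsort Sig T U y)
        ρ y = var (proj₁ y)

lemma49 : (Sig : Signature) (T : CETheory Sig) → ValueConsistent Sig T →
    (U : Signature.Var Sig → Set) → IsTACongruence Sig T U (SimE Sig T U)
lemma49 Sig T consistent U = record
  { well-defined = λ a∼a' b∼b' a∼b → ConvE⇒SimE
      (EqClosure.symmetric _ (ConvCalc⇒ConvE a∼a') ◅◅ SimE⇒ConvE a∼b ◅◅ ConvCalc⇒ConvE b∼b')
  ; equivalence  = record
      { refl  = ConvE⇒SimE ε
      ; sym   = ConvE⇒SimE ∘ EqClosure.symmetric _ ∘ SimE⇒ConvE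
      ; trans = λ a∼b b∼c → ConvE⇒SimE (SimE⇒ConvE a∼b ◅◅ SimE⇒ConvE b∼c)
      }
  ; values-id    = λ {_} {u} du dv u∼v →
      subst (ConvCalc Sig T u) (ConvE-values⇒≡ consistent U du dv (SimE⇒ConvE u∼v)) ε
  ; compatible   = λ f ss∼ts → ConvE⇒SimE (Conv-fun Sig f (ArgsRel-map Sig SimE⇒ConvE ss∼ts))
  }
  where open Conversion Sig T
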